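{- (Provable in CZF$_{exp}$.) Let $X$ be any compact locale. Then the class $Hom(X,\mathsf{Pow}(\{0,1\}))$ is a set.
   Context: CZF$_{exp}$ is Aczel's constructive set theory CZF with Subset Collection replaced by Myhill's Exponentiation Axiom (the class of functions between two sets is a set). A class-frame is a partially ordered class with suprema of all subsets, a top $\top$, binary meets distributing over set-indexed suprema; $\bot=\bigvee\emptyset$. A locale $X$ is a class-frame with a set $B=B_X\subseteq X$ (base) such that for each $x\in X$ the class $\{b\in B:b\le x\}$ is a set and $x=\bigvee\{b\in B:b\le x\}$. A continuous map $f:X\to Y$ is a class function $f^-:B_Y\to X$ with: (1) $\bigvee_{a\in B_Y}f^-(a)=\top$; (2) $f^-(a)\wedge f^-(b)=\bigvee\{f^-(c):c\in B_Y,c\le a,c\le b\}$; (3) $f^-(a)\le\bigvee_{b\in U}f^-(b)$ whenever $a\in B_Y$, $U\subseteq B_Y$ a subset, $a\le\bigvee U$; $Hom(X,Y)$ is the class of these. $X$ is compact if every subset $U\subseteq B$ with $\top=\bigvee U$ has a finite subset $u$ with $\top=\bigvee u$. The locale $\mathsf{Pow}(\{0,1\})$ is the class of subsets of $\{0,1\}$ ordered by inclusion, with base $\{\{0\},\{1\}\}$. -}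

module Defs where

open import Level using (0ℓ)
open import Data.Bool using (Bool; true; false)
open import Data.Product using (Σ; Σ-syntax; _×_; _,_; proj₁; proj₂)
open import Data.List using (List; length; lookup)
open import Data.Fin using (Fin)
open import Relation.Binary.PropositionalEquality using (_≡_)

-- Classes are rendered as types in Set₁, sets as types in Set
-- (Aczel-style reading); a subset of the class is a Set-indexed family.
-- Equality of elements is the order-induced equivalence _≈_.
record ClassFrame : Set₂ where
  infix 4 _≤_ _≈_
  infixr 6 _∧_
  field
    Carrier : Set₁
    _≤_     : Carrier → Carrier → Set
    ≤-refl  : ∀ {x} → x ≤ x
    ≤-trans : ∀ {x y z} → x ≤ y → y ≤ z → x ≤ z
    ⋁       : {I : Set} → (I → Carrier) → Carrier
    ⋁-ub    : ∀ {I : Set} (f : I → Carrier) (i : I) → f i ≤ ⋁ f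
    ⋁-least : ∀ {I : Set} (f : I → Carrier) (x : Carrier) → (∀ i → f i ≤ x) → ⋁ f ≤ x
    ⊤       : Carrier
    ⊤-max   : ∀ {x} → x ≤ ⊤
    _∧_     : Carrier → Carrier → Carrier
    ∧-lb₁   : ∀ {x y} → x ∧ y ≤ x
    ∧-lb₂   : ∀ {x y} → x ∧ y ≤ y
    ∧-glb   : ∀ {x y z} → z ≤ x → z ≤ y → z ≤ x ∧ y
    ∧-distrib-⋁ : ∀ (x : Carrier) {I : Set} (f : I → Carrier) →
                  x ∧ ⋁ f ≤ ⋁ (λ i → x ∧ f i)

  _≈_ : Carrier → Carrier → Set
  x ≈ y = (x ≤ y) × (y ≤ x)

-- For each x, {b ∈ B : b ≤ x} is Σ B (λ b → β b ≤ x), a set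
-- automatically, and x is its supremum (the inequality ⋁{..} ≤ x is automatic).
record Locale : Set₂ where
  field
    frame : ClassFrame
  open ClassFrame frame public
  field
    B          : Set
    β          : B → Carrier
    base-cover : ∀ (x : Carrier) → x ≤ ⋁ {Σ B (λ b → β b ≤ x)} (λ p → β (proj₁ p))

-- Continuous maps X → Y: class functions f⁻ : B_Y → X with (1)-(3).
record Hom (X Y : Locale) : Set₁ where
  private
    module X = Locale X
    module Y = Locale Y
  field
    f⁻   : Y.B → X.Carrier
    top  : X.⊤ X.≤ X.⋁ {Y.B} f⁻
    meet : ∀ (a b : Y.B) →
           f⁻ a X.∧ f⁻ b X.≈
             X.⋁ {Σ Y.B (λ c → (Y.β c Y.≤ Y.β a) × (Y.β c Y.≤ Y.β b))} (λ p → f⁻ (proj₁ p))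
    cover : ∀ (a : Y.B) (U : Y.B → Set) →
            Y.β a Y.≤ Y.⋁ {Σ Y.B U} (λ p → Y.β (proj₁ p)) →
            f⁻ a X.≤ X.⋁ {Σ Y.B U} (λ p → f⁻ (proj₁ p))

_≈Hom_ : {X Y : Locale} → Hom X Y → Hom X Y → Set
_≈Hom_ {X} {Y} f g = ∀ (a : Locale.B Y) → Locale._≈_ X (Hom.f⁻ f a) (Hom.f⁻ g a)

Compact : Locale → Set₁
Compact X = ∀ (U : B → Set) →
  ⊤ ≤ ⋁ {Σ B U} (λ p → β (proj₁ p)) →
  Σ (List (Σ B U)) (λ u → ⊤ ≤ ⋁ {Fin (length u)} (λ i → β (proj₁ (lookup u i))))
  where open Locale X

-- The locale Pow({0,1}): subsets of {0,1} (= Bool) ordered by inclusion,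
-- base {{0},{1}} (indexed by Bool, β b = {b}).
PowFrame : ClassFrame
PowFrame = record
  { Carrier = Bool → Set
  ; _≤_ = λ P Q → ∀ c → P c → Q c
  ; ≤-refl = λ c p → p
  ; ≤-trans = λ f g c p → g c (f c p)
  ; ⋁ = λ {I} f c → Σ I (λ i → f i c)
  ; ⋁-ub = λ f i c p → i , p
  ; ⋁-least = λ f x h c q → h (proj₁ q) c (proj₂ q)
  ; ⊤ = λ _ → Data.Unit.⊤
  ; ⊤-max = λ c _ → Data.Unit.tt
  ; _∧_ = λ P Q c → P c × Q c
  ; ∧-lb₁ = λ c p → proj₁ p
  ; ∧-lb₂ = λ c p → proj₂ p
  ; ∧-glb = λ f g c p → f c p , g c p
  ; ∧-distrib-⋁ = λ x f c p → proj₁ (proj₂ p) , (proj₁ p , proj₂ (proj₂ p))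
  }
  where import Data.Unit

Pow01 : Locale
Pow01 = record
  { frame = PowFrame
  ; B = Bool
  ; β = λ b c → b ≡ c
  ; base-cover = λ x c p → (c , (λ { d Relation.Binary.PropositionalEquality.refl → p })) , Relation.Binary.PropositionalEquality.refl
  }

-- A class (type in Set₁ with equality _≈_) is a set: it is the image of a
-- set S under a class function (equivalently, by Replacement, a set).
IsSet : (A : Set₁) → (A → A → Set) → Set₁
IsSet A _≈_ = Σ Set (λ S → Σ (S → A) (λ e → ∀ (a : A) → Σ S (λ s → e s ≈ a)))

-- A map h : X → Pow({0,1}) is a pair of opens f⁻{0}, f⁻{1} of X which cover
-- X and are disjoint; the cover condition (3) holds automatically, because
-- the base of Pow({0,1}) is discrete.  Refining f⁻{0} ∨ f⁻{1} = ⊤ by basic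
-- opens and applying compactness yields a finite family of basic opens, each
-- tagged with a side it lies below.  For a complemented pair, each member is
-- the join of the cover pieces tagged with its side, so h is determined up
-- to equality by a finite tagged family of basic opens.  Such families form
-- a set (Σ n, Fin n → B × Bool), and together with the proofs of (1)-(2)
-- they index all of Hom(X, Pow({0,1})).
module Submission where

open import Defs
open import Data.Bool using (Bool; true; false; not)
open import Data.Bool.Properties using (not-¬)
open import Data.Product using (Σ; _×_; _,_; proj₁; proj₂)
open import Data.Sum using (_⊎_; inj₁; inj₂)
open import Data.Nat using (ℕ)
open import Data.Fin using (Fin)
open import Data.List using (length; lookup)
open import Data.Empty using (⊥-elim)
open import Function using (_∘_)
open import Relation.Binary.PropositionalEquality using (_≡_; refl; sym; trans; subst)

same-or-opposite : (c b : Bool) → (c ≡ b) ⊎ (c ≡ not b)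
same-or-opposite true  true  = inj₁ refl
same-or-opposite true  false = inj₂ refl
same-or-opposite false true  = inj₂ refl
same-or-opposite false false = inj₁ refl

module FrameFacts (L : ClassFrame) where
  open ClassFrame L

  ⋁-mono : ∀ {I : Set} (f g : I → Carrier) → (∀ i → f i ≤ g i) → ⋁ f ≤ ⋁ g
  ⋁-mono f g f≤g = ⋁-least f (⋁ g) (λ i → ≤-trans (f≤g i) (⋁-ub g i))

  ∧-mono : ∀ {a b c d} → a ≤ c → b ≤ d → a ∧ b ≤ c ∧ d
  ∧-mono a≤c b≤d = ∧-glb (≤-trans ∧-lb₁ a≤c) (≤-trans ∧-lb₂ b≤d)

  -- This is what lets
  -- a finite subcover determine a map into Pow({0,1}).
  complemented-join :
    (P : Bool → Carrier) → (∀ b z → P b ∧ P (not b) ≤ z) →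
    {I : Set} (c : I → Carrier) (tag : I → Bool) →
    (∀ i → c i ≤ P (tag i)) → ⊤ ≤ ⋁ c →
    ∀ b → P b ≈ ⋁ {Σ I (λ i → tag i ≡ b)} (c ∘ proj₁)
  complemented-join P disjoint c tag below covers b =
    ≤-trans (∧-glb ≤-refl (≤-trans ⊤-max covers))
      (≤-trans (∧-distrib-⋁ (P b) c) (⋁-least _ _ piece))
    , ⋁-least _ _ tagged-below
    where
    tagged-below : ∀ (p : Σ _ (λ i → tag i ≡ b)) → c (proj₁ p) ≤ P b
    tagged-below (i , refl) = below i

    -- A piece tagged b lies in the join; one tagged (not b) meets P b in ⊥.
    piece : ∀ i → P b ∧ c i ≤ ⋁ {Σ _ (λ i → tag i ≡ b)} (c ∘ proj₁)
    piece i with same-or-opposite (tag i) b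
    ... | inj₁ e = ≤-trans ∧-lb₂ (⋁-ub (c ∘ proj₁) (i , e))
    ... | inj₂ e = ≤-trans (∧-mono ≤-refl (subst (λ t → c i ≤ P t) e (below i)))
                     (disjoint b _)

module MapsToPow01 (X : Locale) where
  open Locale X
  open FrameFacts frame
  private module P = Locale Pow01

  base-refine : ∀ {I : Set} (f : I → Carrier) →
    ⋁ f ≤ ⋁ {Σ B (λ x → Σ I (λ i → β x ≤ f i))} (β ∘ proj₁)
  base-refine f = ⋁-least f _ (λ i → ≤-trans (base-cover (f i))
    (⋁-least _ _ (λ { (x , x≤fi) → ⋁-ub (β ∘ proj₁) (x , i , x≤fi) })))

  Covers : (Bool → Carrier) → Set
  Covers F = ⊤ ≤ ⋁ F

  Meets : (Bool → Carrier) → Set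
  Meets F = ∀ (a b : Bool) →
    F a ∧ F b ≈ ⋁ {Σ Bool (λ c → (P.β c P.≤ P.β a) × (P.β c P.≤ P.β b))} (F ∘ proj₁)

  disjoint : ∀ {F} → Meets F → ∀ b z → F b ∧ F (not b) ≤ z
  disjoint meets b z = ≤-trans (proj₁ (meets b (not b)))
    (⋁-least _ z (λ { (c , c≤b , c≤¬b) →
      ⊥-elim (not-¬ refl (trans (c≤b c refl) (sym (c≤¬b c refl)))) }))

  -- (1) and (2) suffice: a basic open {a} below a join of basic opens is one
  -- of them, so condition (3) is automatic.
  fromPair : (F : Bool → Carrier) → Covers F → Meets F → Hom X Pow01
  fromPair F covers meets = record
    { f⁻ = F ; top = covers ; meet = meets
    ; cover = λ a U a≤⋁U → member-below a U (a≤⋁U a refl) }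
    where
    member-below : ∀ a (U : Bool → Set) → Σ (Σ Bool U) (λ p → proj₁ p ≡ a) →
                   F a ≤ ⋁ {Σ Bool U} (F ∘ proj₁)
    member-below a U (p , refl) = ⋁-ub (F ∘ proj₁) p

  transport : (h : Hom X Pow01) (F : Bool → Carrier) →
              (∀ b → F b ≈ Hom.f⁻ h b) → Covers F × Meets F
  transport h F F≈f =
    ≤-trans (Hom.top h) (⋁-mono f F (proj₂ ∘ F≈f))
    , λ a b →
      ≤-trans (∧-mono (proj₁ (F≈f a)) (proj₁ (F≈f b)))
        (≤-trans (proj₁ (Hom.meet h a b)) (⋁-mono _ _ (proj₂ ∘ F≈f ∘ proj₁)))
      , ≤-trans (⋁-mono _ _ (proj₁ ∘ F≈f ∘ proj₁))
        (≤-trans (proj₂ (Hom.meet h a b)) (∧-mono (proj₂ (F≈f a)) (proj₂ (F≈f b))))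
    where f = Hom.f⁻ h

  TaggedFamily : Set
  TaggedFamily = Σ ℕ (λ n → Fin n → B × Bool)

  decode : TaggedFamily → Bool → Carrier
  decode (n , g) b = ⋁ {Σ (Fin n) (λ i → proj₂ (g i) ≡ b)} (β ∘ proj₁ ∘ g ∘ proj₁)

  Code : Set
  Code = Σ TaggedFamily (λ d → Covers (decode d) × Meets (decode d))

  embed : Code → Hom X Pow01
  embed (d , covers , meets) = fromPair (decode d) covers meets

  finitely-described : Compact X → (h : Hom X Pow01) →
    Σ TaggedFamily (λ d → ∀ b → decode d b ≈ Hom.f⁻ h b)
  finitely-described compact h = (length u , g) , λ b →
    ≈-sym (complemented-join f (disjoint (Hom.meet h)) (β ∘ proj₁ ∘ g)
             (proj₂ ∘ g) (λ i → proj₂ (proj₂ (lookup u i))) u-covers b)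
    where
    f = Hom.f⁻ h
    U : B → Set
    U x = Σ Bool (λ b → β x ≤ f b)
    subcover = compact U (≤-trans (Hom.top h) (base-refine f))
    u = proj₁ subcover
    u-covers = proj₂ subcover
    g : Fin (length u) → B × Bool
    g i = proj₁ (lookup u i) , proj₁ (proj₂ (lookup u i))
    ≈-sym : ∀ {x y} → x ≈ y → y ≈ x
    ≈-sym (x≤y , y≤x) = y≤x , x≤y

lemma9 : (X : Locale) → Compact X → IsSet (Hom X Pow01) (_≈Hom_ {X} {Pow01})
lemma9 X compact = Code , embed , λ h →
  let (d , d≈h) = finitely-described compact h
  in (d , transport h (decode d) d≈h) , d≈h
  where open MapsToPow01 X
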